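{- Let $G$ be a graph and let $v,v'$ be distinct vertices of $G$ that are false twins, i.e. $N(v)=N(v')$. Let $G'=G-v'$ and let $S'$ be a Grundy total dominating sequence of $G'$. Then $S'$ is a Grundy total dominating sequence of $G$, and $\gamma_{\rm gr}^t(G)=\gamma_{\rm gr}^t(G-v')$.
   Context: All graphs are finite and simple; $N(x)$ is the open neighborhood of $x$ and $G-v'$ is the subgraph induced by $V(G)\setminus\{v'\}$. A sequence $(v_1,\ldots,v_k)$ of distinct vertices is legal if for every $i\in\{1,\ldots,k\}$, $N(v_i)\setminus\bigcup_{j=1}^{i-1}N(v_j)\neq\emptyset$ (the empty sequence is legal). $\gamma_{\rm gr}^t(G)$ is the maximum length of a legal sequence (defined also for graphs with isolated vertices), and a legal sequence of that length is a Grundy total dominating sequence. -}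

module Defs where

open import Data.Nat using (ℕ; suc; _≤_; _<_)
open import Data.Fin using (Fin; toℕ; punchIn)
open import Data.Bool using (Bool; true; false)
open import Data.List using (List; length; lookup; map)
open import Data.List.Relation.Unary.Unique.Propositional using (Unique)
open import Data.Product using (∃; _×_)
open import Relation.Binary.PropositionalEquality using (_≡_)

record Graph (n : ℕ) : Set where
  field
    adj   : Fin n → Fin n → Bool
    sym   : ∀ x y → adj x y ≡ adj y x
    irrefl : ∀ x → adj x x ≡ false
open Graph public

deleteVertex : ∀ {n} → Graph (suc n) → Fin (suc n) → Graph n
deleteVertex G v' = record
  { adj = λ i j → adj G (punchIn v' i) (punchIn v' j)
  ; sym = λ i j → sym G (punchIn v' i) (punchIn v' j)
  ; irrefl = λ i → irrefl G (punchIn v' i)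
  }

Legal : ∀ {n} → Graph n → List (Fin n) → Set
Legal G s =
  Unique s ×
  (∀ (i : Fin (length s)) →
     ∃ λ (u : Fin _) →
       adj G (lookup s i) u ≡ true ×
       (∀ (j : Fin (length s)) → toℕ j < toℕ i → adj G (lookup s j) u ≡ false))

GrundyTDS : ∀ {n} → Graph n → List (Fin n) → Set
GrundyTDS G s = Legal G s × (∀ t → Legal G t → length t ≤ length s)

IsGammaGrT : ∀ {n} → Graph n → ℕ → Set
IsGammaGrT G k =
  (∃ λ s → Legal G s × length s ≡ k) × (∀ t → Legal G t → length t ≤ k)

module Submission where

-- Legality of a sequence only depends on the adjacency pattern
-- among its vertices and their neighbours.  Hence any map f : V(G) → V(H)
-- that preserves adjacency exactly (adj H (f x) (f y) = adj G x y) carries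
-- legal sequences of G to legal sequences of H of the same length; distinct
-- entries stay distinct because distinctness is already forced by the
-- private-neighbour condition.  For false twins v, v' there are two such maps:
-- the inclusion G - v' → G (punchIn v'), and the collapse G → G - v' sending
-- v' to v and every other vertex to itself.  So G and G - v' admit legal
-- sequences of exactly the same lengths, which gives both claims.

open import Defs
open import Data.Nat using (suc; _<_; _≤_; s≤s; z≤n)
open import Data.Fin using (Fin; punchIn; punchOut; toℕ; cast; _≟_)
import Data.Fin as Fin
open import Data.Fin.Properties using (punchIn-punchOut; toℕ-cast)
open import Data.List using (List; []; _∷_; map; length; lookup)
open import Data.List.Properties using (length-map)
open import Data.List.Relation.Unary.All using (All; []; _∷_)
open import Data.List.Relation.Unary.AllPairs using ([]; _∷_)
open import Data.Bool using (true; false)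
open import Data.Product using (∃; _×_; _,_; proj₁)
open import Function.Bundles using (_⇔_; mk⇔)
open import Relation.Nullary using (yes; no)
open import Relation.Binary.PropositionalEquality
  using (_≡_; _≢_; refl; trans; cong; subst; subst₂; cong₂; module ≡-Reasoning)
  renaming (sym to ≡-sym)

HasPrivateNeighbours : ∀ {n} → Graph n → List (Fin n) → Set
HasPrivateNeighbours G s =
  ∀ (i : Fin (length s)) →
    ∃ λ (u : Fin _) →
      adj G (lookup s i) u ≡ true ×
      (∀ (j : Fin (length s)) → toℕ j < toℕ i → adj G (lookup s j) u ≡ false)

privateNeighbours-tail : ∀ {n} (G : Graph n) x xs →
  HasPrivateNeighbours G (x ∷ xs) → HasPrivateNeighbours G xs
privateNeighbours-tail G x xs pn i with pn (Fin.suc i)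
... | u , u∈N , isPrivate = u , u∈N , λ j j<i → isPrivate (Fin.suc j) (s≤s j<i)

true≢false : true ≢ false
true≢false ()

-- Every later entry y has a neighbour outside N(x), so y ≠ x.
head-distinct : ∀ {n} (G : Graph n) x xs →
  HasPrivateNeighbours G (x ∷ xs) → All (x ≢_) xs
head-distinct G x xs pn =
  distinct xs (λ i → let (u , u∈N , isPrivate) = pn (Fin.suc i)
                     in u , u∈N , isPrivate Fin.zero (s≤s z≤n))
  where
  distinct : ∀ ys →
    (∀ (i : Fin (length ys)) →
       ∃ λ u → adj G (lookup ys i) u ≡ true × adj G x u ≡ false) →
    All (x ≢_) ys
  distinct []       outside = []
  distinct (y ∷ ys) outside =
    (λ { refl → let (u , y∼u , x≁u) = outside Fin.zero
                in true≢false (trans (≡-sym y∼u) x≁u) })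
    ∷ distinct ys (λ i → outside (Fin.suc i))

privateNeighbours⇒legal : ∀ {n} (G : Graph n) s →
  HasPrivateNeighbours G s → Legal G s
privateNeighbours⇒legal G []       pn = [] , pn
privateNeighbours⇒legal G (x ∷ xs) pn =
  (head-distinct G x xs pn
     ∷ proj₁ (privateNeighbours⇒legal G xs (privateNeighbours-tail G x xs pn)))
  , pn

lookup-map : ∀ {A B : Set} (f : A → B) xs (i : Fin (length (map f xs))) →
  lookup (map f xs) i ≡ f (lookup xs (cast (length-map f xs) i))
lookup-map f (x ∷ xs) Fin.zero    = refl
lookup-map f (x ∷ xs) (Fin.suc i) = lookup-map f xs i

-- f : V(G) → V(H) preserves and reflects adjacency.  It need not be
-- injective: twins may be sent to the same vertex.
PreservesAdjacency : ∀ {m n} → Graph m → Graph n → (Fin m → Fin n) → Set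
PreservesAdjacency G H f = ∀ x y → adj H (f x) (f y) ≡ adj G x y

legal-map : ∀ {m n} (G : Graph m) (H : Graph n) (f : Fin m → Fin n) →
  PreservesAdjacency G H f → ∀ s → Legal G s → Legal H (map f s)
legal-map G H f pres s (_ , pn) =
  privateNeighbours⇒legal H (map f s) pnH
  where
  index : Fin (length (map f s)) → Fin (length s)
  index = cast (length-map f s)

  adj-image : ∀ i u → adj H (lookup (map f s) i) (f u) ≡ adj G (lookup s (index i)) u
  adj-image i u = trans (cong (λ z → adj H z (f u)) (lookup-map f s i))
                        (pres (lookup s (index i)) u)

  pnH : HasPrivateNeighbours H (map f s)
  pnH i with pn (index i)
  ... | u , u∈N , isPrivate =
    f u , trans (adj-image i u) u∈N ,
    λ j j<i → trans (adj-image j u)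
      (isPrivate (index j) (subst₂ _<_ (≡-sym (toℕ-cast _ j)) (≡-sym (toℕ-cast _ i)) j<i))

LegalTransfer : ∀ {m n} → Graph m → Graph n → Set
LegalTransfer G H = ∀ s → Legal G s → ∃ λ t → Legal H t × length t ≡ length s

legalTransfer-map : ∀ {m n} (G : Graph m) (H : Graph n) (f : Fin m → Fin n) →
  PreservesAdjacency G H f → LegalTransfer G H
legalTransfer-map G H f pres s legal = map f s , legal-map G H f pres s legal , length-map f s

bound-transfer : ∀ {m n} (G : Graph m) (H : Graph n) {k} →
  LegalTransfer G H → (∀ t → Legal H t → length t ≤ k) → ∀ s → Legal G s → length s ≤ k
bound-transfer G H transfer bound s legal with transfer s legal
... | t , legalₜ , t≡s = subst (_≤ _) t≡s (bound t legalₜ)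

gamma-transfer : ∀ {m n} (G : Graph m) (H : Graph n) {k} →
  LegalTransfer G H → LegalTransfer H G → IsGammaGrT G k → IsGammaGrT H k
gamma-transfer G H G→H H→G ((s , legal , s≡k) , bound) with G→H s legal
... | t , legalₜ , t≡s = (t , legalₜ , trans t≡s s≡k) , bound-transfer H G H→G bound

inclusion-preserves : ∀ {n} (G : Graph (suc n)) v' →
  PreservesAdjacency (deleteVertex G v') G (punchIn v')
inclusion-preserves G v' x y = refl

module _ {n} (G : Graph (suc n)) (v v' : Fin (suc n)) (v≢v' : v ≢ v')
         (twins : ∀ u → adj G v u ≡ adj G v' u) where

  merge : Fin (suc n) → Fin (suc n)
  merge x with x ≟ v'
  ... | yes _ = v
  ... | no  _ = x

  -- merge never hits v', so it factors through G - v' via punchOut.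
  merge-avoids : ∀ x → v' ≢ merge x
  merge-avoids x with x ≟ v'
  ... | yes _   = λ v'≡v → v≢v' (≡-sym v'≡v)
  ... | no  x≢v' = λ v'≡x → x≢v' (≡-sym v'≡x)

  merge-adjˡ : ∀ x y → adj G (merge x) y ≡ adj G x y
  merge-adjˡ x y with x ≟ v'
  ... | yes refl = twins y
  ... | no  _    = refl

  merge-adj : ∀ x y → adj G (merge x) (merge y) ≡ adj G x y
  merge-adj x y = begin
    adj G (merge x) (merge y) ≡⟨ merge-adjˡ x (merge y) ⟩
    adj G x (merge y)         ≡⟨ sym G x (merge y) ⟩
    adj G (merge y) x         ≡⟨ merge-adjˡ y x ⟩
    adj G y x                 ≡⟨ sym G y x ⟩
    adj G x y                 ∎
    where open ≡-Reasoning

  collapse : Fin (suc n) → Fin n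
  collapse x = punchOut (merge-avoids x)

  collapse-preserves : PreservesAdjacency G (deleteVertex G v') collapse
  collapse-preserves x y = begin
    adj G (punchIn v' (collapse x)) (punchIn v' (collapse y))
      ≡⟨ cong₂ (adj G) (punchIn-punchOut (merge-avoids x)) (punchIn-punchOut (merge-avoids y)) ⟩
    adj G (merge x) (merge y)
      ≡⟨ merge-adj x y ⟩
    adj G x y ∎
    where open ≡-Reasoning

proposition3p6 :
    ∀ {n} (G : Graph (suc n)) (v v' : Fin (suc n)) →
    v ≢ v' →
    (∀ u → adj G v u ≡ adj G v' u) →
    (S' : List (Fin n)) →
    GrundyTDS (deleteVertex G v') S' →
    GrundyTDS G (map (punchIn v') S') ×
    (∀ k → IsGammaGrT G k ⇔ IsGammaGrT (deleteVertex G v') k)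
proposition3p6 G v v' v≢v' twins S' (legalS' , maximalS') =
  (legal-map G' G (punchIn v') (inclusion-preserves G v') S' legalS' ,
   bound-transfer G G' G→G' maximal-in-G') ,
  λ k → mk⇔ (gamma-transfer G G' G→G' G'→G) (gamma-transfer G' G G'→G G→G')
  where
  G' = deleteVertex G v'

  G→G' : LegalTransfer G G'
  G→G' = legalTransfer-map G G' (collapse G v v' v≢v' twins)
                                (collapse-preserves G v v' v≢v' twins)

  G'→G : LegalTransfer G' G
  G'→G = legalTransfer-map G' G (punchIn v') (inclusion-preserves G v')

  maximal-in-G' : ∀ t → Legal G' t → length t ≤ length (map (punchIn v') S')
  maximal-in-G' t legal =
    subst (length t ≤_) (≡-sym (length-map (punchIn v') S')) (maximalS' t legal)
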